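{- Let $G$ be a $\gamma_t$-critical graph of order $n$ with minimum degree $\delta(G)\ge 2$ and $\gamma_t(G)=n-\Delta(G)$. Let $v$ be a vertex of degree $\Delta(G)$, let $S=V(G)\setminus N[v]$, and let $H_1,\dots,H_t$ be the connected components of the induced subgraph $G[S]$. Then: (1) each $H_i$ is isomorphic to $P_2$ or $P_3$; (2) if $G[S]$ has a component isomorphic to $P_3$, then $G[S]$ is itself a path $u_1u_2u_3$, $N(u_2)\cap N(v)=\emptyset$, and $N(v)$ is the disjoint union of the nonempty sets $N(u_1)\setminus\{u_2\}$ and $N(u_3)\setminus\{u_2\}$; (3) if every $H_i$ is a $P_2$, say $H_i=u_iw_i$, then $N(u)\cap N(v)\neq\emptyset$ for every $u\in S$, and $N(v)$ is the disjoint union of the sets $N(u_1)\setminus\{w_1\}, N(w_1)\setminus\{u_1\},\dots,N(u_t)\setminus\{w_t\},N(w_t)\setminus\{u_t\}$.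
   Context: For a graph $G$, a set $S\subseteq V(G)$ is a total dominating set if every vertex of $G$ is adjacent to some vertex of $S$; $\gamma_t(G)$ is the minimum size of such a set. A leaf is a vertex of degree one. A graph $G$ with no isolated vertex is $\gamma_t$-critical if $\gamma_t(G-v)<\gamma_t(G)$ for every vertex $v$ not adjacent to a leaf. $N(x)$ denotes the neighborhood of $x$ and $N[x]=N(x)\cup\{x\}$; $P_k$ is the path on $k$ vertices. -}

module Defs where

open import Data.Nat using (ℕ; zero; suc; _+_; _≤_; _<_)
open import Data.Bool using (Bool; true; false)
open import Data.Fin using (Fin; toℕ)
open import Data.Fin.Subset using (Subset; _∈_; _∉_; ∣_∣)
open import Data.Vec using (tabulate)
open import Data.Product using (Σ; ∃; _×_; _,_)
open import Data.Sum using (_⊎_)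
open import Relation.Nullary using (¬_)
open import Relation.Binary.PropositionalEquality using (_≡_; _≢_)
open import Function.Bundles using (_⇔_)
open import Function.Definitions using (Injective)

record Graph (n : ℕ) : Set where
  field
    E     : Fin n → Fin n → Bool
    sym   : ∀ x y → E x y ≡ E y x
    irref : ∀ x → E x x ≡ false

module _ {n : ℕ} (G : Graph n) where
  open Graph G

  Adj : Fin n → Fin n → Set
  Adj x y = E x y ≡ true

  N : Fin n → Subset n
  N x = tabulate (E x)

  deg : Fin n → ℕ
  deg x = ∣ N x ∣

  IsMaxDeg : Fin n → Set
  IsMaxDeg v = ∀ y → deg y ≤ deg v

  MinDeg≥2 : Set
  MinDeg≥2 = ∀ x → 2 ≤ deg x

  NoIsolated : Set
  NoIsolated = ∀ x → ∃ λ y → Adj x y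

  IsTDS : Subset n → Set
  IsTDS S = ∀ x → ∃ λ y → y ∈ S × Adj x y

  IsTDS-del : Fin n → Subset n → Set
  IsTDS-del v S = v ∉ S × (∀ x → x ≢ v → ∃ λ y → y ∈ S × Adj x y)

  IsγT : ℕ → Set
  IsγT k = (∃ λ S → IsTDS S × ∣ S ∣ ≡ k) × (∀ S → IsTDS S → k ≤ ∣ S ∣)

  AdjLeaf : Fin n → Set
  AdjLeaf v = ∃ λ y → Adj v y × deg y ≡ 1

  -- γ_t-critical: no isolated vertex, and γ_t(G - v) < γ_t(G) for every v
  -- not adjacent to a leaf (γ_t(G-v) < k  iff  G-v has a TDS of size < k)
  γt-critical : Set
  γt-critical = NoIsolated ×
    (∀ k → IsγT k → ∀ v → ¬ AdjLeaf v →
       ∃ λ S → IsTDS-del v S × ∣ S ∣ < k)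

  OutS : Fin n → Fin n → Set
  OutS v y = y ≢ v × ¬ Adj v y

  data Reach (C : Fin n → Set) (x : Fin n) : Fin n → Set where
    here : C x → Reach C x x
    step : ∀ {y z} → Reach C x y → Adj y z → C z → Reach C x z

  Comp : (Fin n → Set) → Fin n → Fin n → Set
  Comp C x y = Reach C x y

  PathAdj : {k : ℕ} → Fin k → Fin k → Set
  PathAdj i j = suc (toℕ i) ≡ toℕ j ⊎ suc (toℕ j) ≡ toℕ i

  IsPathIso : (C : Fin n → Set) (k : ℕ) → (Fin k → Fin n) → Set
  IsPathIso C k f =
    Injective _≡_ _≡_ f ×
    (∀ i → C (f i)) ×
    (∀ x → C x → ∃ λ i → f i ≡ x) ×
    (∀ i j → Adj (f i) (f j) ⇔ PathAdj i j)

  IsoPath : (Fin n → Set) → ℕ → Set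
  IsoPath C k = ∃ λ f → IsPathIso C k f

  InNminus : Fin n → Fin n → Fin n → Set
  InNminus u w x = x ∈ N u × x ≢ w

-- Write S = V ∖ N[v], so that |S| + 1 ≤ n − deg v = γ_t(G). Criticality at v
-- yields a total dominating set of G − v smaller than γ_t(G); it cannot meet
-- N(v), since it would then dominate G, so it lies in S and every vertex other
-- than v has a neighbour in S. Conversely, if a set T meets N(v), then adding v
-- and a neighbour of every vertex of S not dominated by T gives a total
-- dominating set of G, and comparing its size with γ_t(G) shows that T
-- dominates at most |T| vertices of S. For T = {a} and T = {a, s} with
-- a ∈ N(v) this says that every vertex of N(v) has exactly one neighbour in S,
-- and that if s ∈ S has two neighbours b, c in S, then the S-neighbour of every
-- vertex of N(v) is b or c.
module Submission where

open import Defs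
open import Data.Nat using (ℕ; zero; suc; _+_; _∸_; _≤_; _<_; z≤n; s≤s; s≤s⁻¹)
open import Data.Nat.Properties
  using ( ≤-trans; ≤-reflexive; <⇒≱; n≮n; +-suc; +-monoʳ-≤; +-monoˡ-≤; +-cancelʳ-≤; ∸-monoʳ-<
        ; module ≤-Reasoning )
import Data.Bool as Bool
open import Data.Fin using (Fin; zero; suc; _≟_)
open import Data.Fin.Properties using (any?)
open import Data.Fin.Subset
  using (Subset; inside; outside; _∈_; _∉_; _⊆_; ∣_∣; ⁅_⁆; _∪_; _∩_; _─_; ∁; ⊥)
open import Data.Fin.Subset.Properties
  using ( x∈⁅x⁆; x∈⁅y⁆⇒x≡y; ∣⁅x⁆∣≡1; ∣⊥∣≡0; ∣p∣≤n; ∣p∣≤∣x∷p∣; ∣∁p∣≡n∸∣p∣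
        ; p⊆p∪q; q⊆p∪q; x∈p∪q⁺; x∈p∪q⁻; x∈p∩q⁺; x∈p∧x∉q⇒x∈p─q
        ; x∉p⇒x∈∁p; p⊆q⇒∣p∣≤∣q∣; p⊂q⇒∣p∣<∣q∣; _∈?_ )
open import Data.Vec using (_∷_; []; here; there)
open import Data.Vec.Properties using ([]=⇒lookup; lookup⇒[]=; lookup∘tabulate)
open import Data.Product using (∃; ∃₂; _×_; _,_; proj₁; proj₂)
open import Data.Sum using (_⊎_; inj₁; inj₂; [_,_]′)
open import Data.Empty using (⊥-elim) renaming (⊥ to Empty)
open import Relation.Nullary using (¬_; yes; no; ¬?; contradiction)
open import Relation.Nullary.Decidable using (_×-dec_; decidable-stable)
open import Relation.Unary using (Decidable)
open import Relation.Binary.PropositionalEquality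
  using (_≡_; _≢_; refl; sym; trans; cong; cong₂; subst)
open import Function using (_∘_)
open import Function.Bundles using (_⇔_; mk⇔; Equivalence)
open import Function.Definitions using (Injective)

private variable n : ℕ

∣p∪q∣≤∣p∣+∣q∣ : (p q : Subset n) → ∣ p ∪ q ∣ ≤ ∣ p ∣ + ∣ q ∣
∣p∪q∣≤∣p∣+∣q∣ [] [] = z≤n
∣p∪q∣≤∣p∣+∣q∣ (inside ∷ p) (t ∷ q) =
  s≤s (≤-trans (∣p∪q∣≤∣p∣+∣q∣ p q) (+-monoʳ-≤ ∣ p ∣ (∣p∣≤∣x∷p∣ t q)))
∣p∪q∣≤∣p∣+∣q∣ (outside ∷ p) (inside ∷ q) rewrite +-suc ∣ p ∣ ∣ q ∣ = s≤s (∣p∪q∣≤∣p∣+∣q∣ p q)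
∣p∪q∣≤∣p∣+∣q∣ (outside ∷ p) (outside ∷ q) = ∣p∪q∣≤∣p∣+∣q∣ p q

∣p∣≡∣p∩q∣+∣p─q∣ : (p q : Subset n) → ∣ p ∣ ≡ ∣ p ∩ q ∣ + ∣ p ─ q ∣
∣p∣≡∣p∩q∣+∣p─q∣ [] [] = refl
∣p∣≡∣p∩q∣+∣p─q∣ (inside ∷ p) (inside ∷ q) = cong suc (∣p∣≡∣p∩q∣+∣p─q∣ p q)
∣p∣≡∣p∩q∣+∣p─q∣ (inside ∷ p) (outside ∷ q) =
  trans (cong suc (∣p∣≡∣p∩q∣+∣p─q∣ p q)) (sym (+-suc ∣ p ∩ q ∣ ∣ p ─ q ∣))
∣p∣≡∣p∩q∣+∣p─q∣ (outside ∷ p) (inside ∷ q) = ∣p∣≡∣p∩q∣+∣p─q∣ p q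
∣p∣≡∣p∩q∣+∣p─q∣ (outside ∷ p) (outside ∷ q) = ∣p∣≡∣p∩q∣+∣p─q∣ p q

x∉p⇒∣p∣<∣⁅x⁆∪p∣ : ∀ {x : Fin n} {p : Subset n} → x ∉ p → ∣ p ∣ < ∣ ⁅ x ⁆ ∪ p ∣
x∉p⇒∣p∣<∣⁅x⁆∪p∣ {x = x} {p} x∉p = p⊂q⇒∣p∣<∣q∣ (q⊆p∪q ⁅ x ⁆ p , x , p⊆p∪q p (x∈⁅x⁆ x) , x∉p)

x∈⁅y⁆∪⁅z⁆⁻ : ∀ {x y z : Fin n} → x ∈ ⁅ y ⁆ ∪ ⁅ z ⁆ → x ≡ y ⊎ x ≡ z
x∈⁅y⁆∪⁅z⁆⁻ {y = y} {z} x∈ with x∈p∪q⁻ ⁅ y ⁆ ⁅ z ⁆ x∈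
... | inj₁ x∈⁅y⁆ = inj₁ (x∈⁅y⁆⇒x≡y y x∈⁅y⁆)
... | inj₂ x∈⁅z⁆ = inj₂ (x∈⁅y⁆⇒x≡y z x∈⁅z⁆)

x∈⁅y⁆∪⁅z⁆∪⁅w⁆⁻ : ∀ {x y z w : Fin n} → x ∈ ⁅ y ⁆ ∪ (⁅ z ⁆ ∪ ⁅ w ⁆) → x ≡ y ⊎ x ≡ z ⊎ x ≡ w
x∈⁅y⁆∪⁅z⁆∪⁅w⁆⁻ {y = y} {z} {w} x∈ with x∈p∪q⁻ ⁅ y ⁆ (⁅ z ⁆ ∪ ⁅ w ⁆) x∈
... | inj₁ x∈⁅y⁆ = inj₁ (x∈⁅y⁆⇒x≡y y x∈⁅y⁆)
... | inj₂ x∈⁅z⁆∪⁅w⁆ = inj₂ (x∈⁅y⁆∪⁅z⁆⁻ x∈⁅z⁆∪⁅w⁆)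

∣⁅x⁆∪⁅y⁆∣≤2 : (x y : Fin n) → ∣ ⁅ x ⁆ ∪ ⁅ y ⁆ ∣ ≤ 2
∣⁅x⁆∪⁅y⁆∣≤2 x y = ≤-trans (∣p∪q∣≤∣p∣+∣q∣ ⁅ x ⁆ ⁅ y ⁆) (≤-reflexive (cong₂ _+_ (∣⁅x⁆∣≡1 x) (∣⁅x⁆∣≡1 y)))

x≢y⇒2≤∣⁅x⁆∪⁅y⁆∣ : ∀ {x y : Fin n} → x ≢ y → 2 ≤ ∣ ⁅ x ⁆ ∪ ⁅ y ⁆ ∣
x≢y⇒2≤∣⁅x⁆∪⁅y⁆∣ {x = x} {y} x≢y =
  subst (λ m → suc m ≤ ∣ ⁅ x ⁆ ∪ ⁅ y ⁆ ∣) (∣⁅x⁆∣≡1 y) (x∉p⇒∣p∣<∣⁅x⁆∪p∣ (x≢y ∘ x∈⁅y⁆⇒x≡y y))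

distinct⇒3≤∣⁅x⁆∪⁅y⁆∪⁅z⁆∣ : ∀ {x y z : Fin n} → x ≢ y → x ≢ z → y ≢ z →
                            3 ≤ ∣ ⁅ x ⁆ ∪ (⁅ y ⁆ ∪ ⁅ z ⁆) ∣
distinct⇒3≤∣⁅x⁆∪⁅y⁆∪⁅z⁆∣ x≢y x≢z y≢z =
  ≤-trans (s≤s (x≢y⇒2≤∣⁅x⁆∪⁅y⁆∣ y≢z)) (x∉p⇒∣p∣<∣⁅x⁆∪p∣ ([ x≢y , x≢z ]′ ∘ x∈⁅y⁆∪⁅z⁆⁻))

image : ∀ {m n} → (Fin m → Fin n) → Subset m → Subset n
image f [] = ⊥
image f (inside ∷ p) = ⁅ f zero ⁆ ∪ image (f ∘ suc) p
image f (outside ∷ p) = image (f ∘ suc) p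

x∈p⇒f[x]∈image : ∀ {m n} (f : Fin m → Fin n) (p : Subset m) {x} → x ∈ p → f x ∈ image f p
x∈p⇒f[x]∈image f (inside ∷ p) here = x∈p∪q⁺ (inj₁ (x∈⁅x⁆ (f zero)))
x∈p⇒f[x]∈image f (inside ∷ p) (there x∈p) = x∈p∪q⁺ (inj₂ (x∈p⇒f[x]∈image (f ∘ suc) p x∈p))
x∈p⇒f[x]∈image f (outside ∷ p) (there x∈p) = x∈p⇒f[x]∈image (f ∘ suc) p x∈p

∣image∣≤∣p∣ : ∀ {m n} (f : Fin m → Fin n) (p : Subset m) → ∣ image f p ∣ ≤ ∣ p ∣
∣image∣≤∣p∣ {n = n} f [] = ≤-reflexive (∣⊥∣≡0 n)
∣image∣≤∣p∣ f (inside ∷ p) = ≤-trans (∣p∪q∣≤∣p∣+∣q∣ ⁅ f zero ⁆ (image (f ∘ suc) p))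
  (subst (λ m → m + ∣ image (f ∘ suc) p ∣ ≤ suc ∣ p ∣) (sym (∣⁅x⁆∣≡1 (f zero))) (s≤s (∣image∣≤∣p∣ (f ∘ suc) p)))
∣image∣≤∣p∣ f (outside ∷ p) = ∣image∣≤∣p∣ (f ∘ suc) p

no-three-distinct-in-image-of-Fin2 : ∀ {A : Set} (g : Fin 2 → A) {a b c : A} →
  (∃ λ i → g i ≡ a) → (∃ λ j → g j ≡ b) → (∃ λ l → g l ≡ c) → a ≢ b → a ≢ c → b ≢ c → Empty
no-three-distinct-in-image-of-Fin2 g (zero , refl) (zero , refl) _ a≢b _ _ = a≢b refl
no-three-distinct-in-image-of-Fin2 g (suc zero , refl) (suc zero , refl) _ a≢b _ _ = a≢b refl
no-three-distinct-in-image-of-Fin2 g (zero , refl) (suc zero , refl) (zero , refl) _ a≢c _ = a≢c refl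
no-three-distinct-in-image-of-Fin2 g (zero , refl) (suc zero , refl) (suc zero , refl) _ _ b≢c = b≢c refl
no-three-distinct-in-image-of-Fin2 g (suc zero , refl) (zero , refl) (zero , refl) _ _ b≢c = b≢c refl
no-three-distinct-in-image-of-Fin2 g (suc zero , refl) (zero , refl) (suc zero , refl) _ a≢c _ = a≢c refl

both⇔ : ∀ {A B : Set} → A → B → A ⇔ B
both⇔ a b = mk⇔ (λ _ → b) (λ _ → a)

neither⇔ : ∀ {A B : Set} → ¬ A → ¬ B → A ⇔ B
neither⇔ ¬a ¬b = mk⇔ (λ a → contradiction a ¬a) (λ b → contradiction b ¬b)

module _ (G : Graph n) where

  Adj-sym : ∀ {x y} → Adj G x y → Adj G y x
  Adj-sym {x} {y} xy = trans (Graph.sym G y x) xy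

  ¬Adj-refl : ∀ {x} → ¬ Adj G x x
  ¬Adj-refl {x} xx with trans (sym xx) (Graph.irref G x)
  ... | ()

  Adj⇒≢ : ∀ {x y} → Adj G x y → x ≢ y
  Adj⇒≢ xy refl = ¬Adj-refl xy

  Adj? : ∀ x → Decidable (Adj G x)
  Adj? x y = Graph.E G x y Bool.≟ Bool.true

  Adj⇒∈N : ∀ {x y} → Adj G x y → y ∈ N G x
  Adj⇒∈N {x} {y} xy = lookup⇒[]= y (N G x) (trans (lookup∘tabulate (Graph.E G x) y) xy)

  ∈N⇒Adj : ∀ {x y} → y ∈ N G x → Adj G x y
  ∈N⇒Adj {x} {y} y∈N = trans (sym (lookup∘tabulate (Graph.E G x) y)) ([]=⇒lookup y∈N)

  module _ (δ≥2 : MinDeg≥2 G) where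

    InNminus-nonempty : ∀ x z → ∃ (InNminus G x z)
    InNminus-nonempty x z with any? (λ y → (y ∈? N G x) ×-dec ¬? (y ≟ z))
    ... | yes found = found
    ... | no none = ⊥-elim (n≮n 1 (≤-trans (δ≥2 x) deg≤1))
      where
      N⊆⁅z⁆ : N G x ⊆ ⁅ z ⁆
      N⊆⁅z⁆ {y} y∈N with y ≟ z
      ... | yes refl = x∈⁅x⁆ z
      ... | no y≢z = contradiction (y , y∈N , y≢z) none

      deg≤1 : deg G x ≤ 1
      deg≤1 = ≤-trans (p⊆q⇒∣p∣≤∣q∣ N⊆⁅z⁆) (≤-reflexive (∣⁅x⁆∣≡1 z))

    ¬AdjLeaf : ∀ x → ¬ AdjLeaf G x
    ¬AdjLeaf x (y , _ , deg≡1) = n≮n 1 (subst (2 ≤_) deg≡1 (δ≥2 y))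

  Reach⇒member : ∀ {C x y} → Reach G C x y → C y
  Reach⇒member (here Cx) = Cx
  Reach⇒member (step _ _ Cy) = Cy

  Reach-closed-pair : ∀ {C x y} → (∀ {z} → C z → Adj G x z → z ≡ y) → (∀ {z} → C z → Adj G y z → z ≡ x) →
                      ∀ {w} → Reach G C x w → w ≡ x ⊎ w ≡ y
  Reach-closed-pair only-y only-x (here _) = inj₁ refl
  Reach-closed-pair only-y only-x (step r uw Cw) with Reach-closed-pair only-y only-x r
  ... | inj₁ refl = inj₂ (only-y Cw uw)
  ... | inj₂ refl = inj₁ (only-x Cw uw)

  path2 : Fin n → Fin n → Fin 2 → Fin n
  path2 x y zero = x
  path2 x y (suc zero) = y

  path3 : Fin n → Fin n → Fin n → Fin 3 → Fin n
  path3 p c q zero = p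
  path3 p c q (suc zero) = c
  path3 p c q (suc (suc zero)) = q

  path2-injective : ∀ {x y} → Adj G x y → Injective _≡_ _≡_ (path2 x y)
  path2-injective xy {zero} {zero} _ = refl
  path2-injective xy {zero} {suc zero} x≡y = contradiction x≡y (Adj⇒≢ xy)
  path2-injective xy {suc zero} {zero} y≡x = contradiction (sym y≡x) (Adj⇒≢ xy)
  path2-injective xy {suc zero} {suc zero} _ = refl

  path2-Adj⇔ : ∀ {x y} → Adj G x y → ∀ i j → Adj G (path2 x y i) (path2 x y j) ⇔ PathAdj G i j
  path2-Adj⇔ xy zero zero = neither⇔ ¬Adj-refl λ { (inj₁ ()) ; (inj₂ ()) }
  path2-Adj⇔ xy zero (suc zero) = both⇔ xy (inj₁ refl)
  path2-Adj⇔ xy (suc zero) zero = both⇔ (Adj-sym xy) (inj₂ refl)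
  path2-Adj⇔ xy (suc zero) (suc zero) = neither⇔ ¬Adj-refl λ { (inj₁ ()) ; (inj₂ ()) }

  path3-injective : ∀ {p c q} → Adj G c p → Adj G c q → p ≢ q → Injective _≡_ _≡_ (path3 p c q)
  path3-injective cp cq p≢q {zero} {zero} _ = refl
  path3-injective cp cq p≢q {zero} {suc zero} p≡c = contradiction (sym p≡c) (Adj⇒≢ cp)
  path3-injective cp cq p≢q {zero} {suc (suc zero)} p≡q = contradiction p≡q p≢q
  path3-injective cp cq p≢q {suc zero} {zero} c≡p = contradiction c≡p (Adj⇒≢ cp)
  path3-injective cp cq p≢q {suc zero} {suc zero} _ = refl
  path3-injective cp cq p≢q {suc zero} {suc (suc zero)} c≡q = contradiction c≡q (Adj⇒≢ cq)
  path3-injective cp cq p≢q {suc (suc zero)} {zero} q≡p = contradiction (sym q≡p) p≢q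
  path3-injective cp cq p≢q {suc (suc zero)} {suc zero} q≡c = contradiction (sym q≡c) (Adj⇒≢ cq)
  path3-injective cp cq p≢q {suc (suc zero)} {suc (suc zero)} _ = refl

  path3-Adj⇔ : ∀ {p c q} → Adj G c p → Adj G c q → ¬ Adj G p q →
               ∀ i j → Adj G (path3 p c q i) (path3 p c q j) ⇔ PathAdj G i j
  path3-Adj⇔ cp cq ¬pq zero zero = neither⇔ ¬Adj-refl λ { (inj₁ ()) ; (inj₂ ()) }
  path3-Adj⇔ cp cq ¬pq zero (suc zero) = both⇔ (Adj-sym cp) (inj₁ refl)
  path3-Adj⇔ cp cq ¬pq zero (suc (suc zero)) = neither⇔ ¬pq λ { (inj₁ ()) ; (inj₂ ()) }
  path3-Adj⇔ cp cq ¬pq (suc zero) zero = both⇔ cp (inj₂ refl)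
  path3-Adj⇔ cp cq ¬pq (suc zero) (suc zero) = neither⇔ ¬Adj-refl λ { (inj₁ ()) ; (inj₂ ()) }
  path3-Adj⇔ cp cq ¬pq (suc zero) (suc (suc zero)) = both⇔ cq (inj₁ refl)
  path3-Adj⇔ cp cq ¬pq (suc (suc zero)) zero = neither⇔ (¬pq ∘ Adj-sym) λ { (inj₁ ()) ; (inj₂ ()) }
  path3-Adj⇔ cp cq ¬pq (suc (suc zero)) (suc zero) = both⇔ (Adj-sym cq) (inj₂ refl)
  path3-Adj⇔ cp cq ¬pq (suc (suc zero)) (suc (suc zero)) = neither⇔ ¬Adj-refl λ { (inj₁ ()) ; (inj₂ ()) }

module CriticalWithγt≡n∸deg (G : Graph n) (crit : γt-critical G) (δ≥2 : MinDeg≥2 G)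
               (k : ℕ) (γt≡k : IsγT G k) (v : Fin n) (k≡n∸deg : k ≡ n ∸ deg G v) where

  InS : Fin n → Set
  InS = OutS G v

  InS? : Decidable InS
  InS? y = ¬? (y ≟ v) ×-dec ¬? (Adj? G v y)

  S : Subset n
  S = ∁ (⁅ v ⁆ ∪ N G v)

  InS⇒∈S : ∀ {y} → InS y → y ∈ S
  InS⇒∈S (y≢v , ¬vy) = x∉p⇒x∈∁p ([ y≢v ∘ x∈⁅y⁆⇒x≡y v , ¬vy ∘ ∈N⇒Adj G ]′ ∘ x∈p∪q⁻ ⁅ v ⁆ (N G v))

  suc∣S∣≤k : suc ∣ S ∣ ≤ k
  suc∣S∣≤k = begin
    suc ∣ S ∣                    ≡⟨ cong suc (∣∁p∣≡n∸∣p∣ (⁅ v ⁆ ∪ N G v)) ⟩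
    suc (n ∸ ∣ ⁅ v ⁆ ∪ N G v ∣)  ≤⟨ ∸-monoʳ-< (x∉p⇒∣p∣<∣⁅x⁆∪p∣ (¬Adj-refl G ∘ ∈N⇒Adj G)) (∣p∣≤n (⁅ v ⁆ ∪ N G v)) ⟩
    n ∸ deg G v                  ≡⟨ k≡n∸deg ⟨
    k                            ∎
    where open ≤-Reasoning

  SNbr : Fin n → Fin n → Set
  SNbr x y = InS y × Adj G x y

  S-neighbour : ∀ x → x ≢ v → ∃ (SNbr x)
  S-neighbour x x≢v with proj₂ crit k γt≡k v (¬AdjLeaf G δ≥2 v)
  ... | D , (v∉D , D-dominates-G-v) , ∣D∣<k with D-dominates-G-v x x≢v
  ... | y , y∈D , xy = y , (y≢v , ¬vy) , xy
    where
    y≢v : y ≢ v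
    y≢v refl = v∉D y∈D

    ¬vy : ¬ Adj G v y
    ¬vy vy = <⇒≱ ∣D∣<k (proj₂ γt≡k D D-dominates-G)
      where
      D-dominates-G : IsTDS G D
      D-dominates-G z with z ≟ v
      ... | yes refl = y , y∈D , vy
      ... | no z≢v = D-dominates-G-v z z≢v

  neighbour-of-v-has-SNbr : ∀ {a} → Adj G v a → ∃ (SNbr a)
  neighbour-of-v-has-SNbr va = S-neighbour _ (Adj⇒≢ G va ∘ sym)

  anchor : ∃₂ λ a x → Adj G v a × SNbr a x
  anchor with proj₁ crit v
  ... | a , va with neighbour-of-v-has-SNbr va
  ... | x , ax = a , x , va , ax

  N[v]-vertex≢InS : ∀ {y c} → Adj G v y → InS c → y ≢ c
  N[v]-vertex≢InS vy (_ , ¬vc) refl = ¬vc vy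

  InS-neighbour-split : ∀ {u y} → InS u → Adj G u y → Adj G v y ⊎ InS y
  InS-neighbour-split {y = y} (_ , ¬vu) uy with Adj? G v y
  ... | yes vy = inj₁ vy
  ... | no ¬vy = inj₂ ((λ { refl → ¬vu (Adj-sym G uy) }) , ¬vy)

  sole-SNbr⇒N∖w⊆N[v] : ∀ {u w y} → InS u → (∀ {z} → SNbr u z → z ≡ w) → InNminus G u w y → y ∈ N G v
  sole-SNbr⇒N∖w⊆N[v] u∈S sole (y∈Nu , y≢w) with InS-neighbour-split u∈S (∈N⇒Adj G y∈Nu)
  ... | inj₁ vy = Adj⇒∈N G vy
  ... | inj₂ y∈S = contradiction (sole (y∈S , ∈N⇒Adj G y∈Nu)) y≢w

  -- {v} ∪ T together with a neighbour of each vertex of S ∖ X is a total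
  -- dominating set of G, of size at most 1 + |T| + |S| − |X|.
  dominated-bound : ∀ {a} {T X : Subset n} → Adj G v a → a ∈ T → X ⊆ S →
                    (∀ {x} → x ∈ X → ∃ λ t → t ∈ T × Adj G x t) → ∣ X ∣ ≤ ∣ T ∣
  dominated-bound {a} {T} {X} va a∈T X⊆S T-dominates-X =
    +-cancelʳ-≤ (∣ R ∣) (∣ X ∣) (∣ T ∣) (s≤s⁻¹ (begin
      suc (∣ X ∣ + ∣ R ∣)      ≤⟨ s≤s (+-monoˡ-≤ ∣ R ∣ (p⊆q⇒∣p∣≤∣q∣ λ x∈X → x∈p∩q⁺ (X⊆S x∈X , x∈X))) ⟩
      suc (∣ S ∩ X ∣ + ∣ R ∣)  ≡⟨ cong suc (∣p∣≡∣p∩q∣+∣p─q∣ S X) ⟨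
      suc ∣ S ∣                ≤⟨ suc∣S∣≤k ⟩
      k                        ≤⟨ proj₂ γt≡k D D-dominates ⟩
      ∣ D ∣                    ≤⟨ ∣D∣≤ ⟩
      suc (∣ T ∣ + ∣ R ∣)      ∎))
    where
    open ≤-Reasoning

    R : Subset n
    R = S ─ X

    neighbour : Fin n → Fin n
    neighbour x = proj₁ (proj₁ crit x)

    D : Subset n
    D = ⁅ v ⁆ ∪ (T ∪ image neighbour R)

    v∈D : v ∈ D
    v∈D = x∈p∪q⁺ (inj₁ (x∈⁅x⁆ v))

    T⊆D : T ⊆ D
    T⊆D t∈T = x∈p∪q⁺ (inj₂ (x∈p∪q⁺ (inj₁ t∈T)))

    neighbour∈D : ∀ {x} → x ∈ R → neighbour x ∈ D
    neighbour∈D x∈R = x∈p∪q⁺ (inj₂ (x∈p∪q⁺ (inj₂ (x∈p⇒f[x]∈image neighbour R x∈R))))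

    D-dominates : IsTDS G D
    D-dominates x with x ≟ v
    ... | yes refl = a , T⊆D a∈T , va
    ... | no x≢v with Adj? G v x
    ... | yes vx = v , v∈D , Adj-sym G vx
    ... | no ¬vx with x ∈? X
    ... | yes x∈X = let t , t∈T , xt = T-dominates-X x∈X in t , T⊆D t∈T , xt
    ... | no x∉X = neighbour x , neighbour∈D (x∈p∧x∉q⇒x∈p─q (InS⇒∈S (x≢v , ¬vx)) x∉X) , proj₂ (proj₁ crit x)

    ∣D∣≤ : ∣ D ∣ ≤ suc (∣ T ∣ + ∣ R ∣)
    ∣D∣≤ = begin
      ∣ D ∣                                   ≤⟨ ∣p∪q∣≤∣p∣+∣q∣ ⁅ v ⁆ (T ∪ image neighbour R) ⟩
      ∣ ⁅ v ⁆ ∣ + ∣ T ∪ image neighbour R ∣   ≡⟨ cong (_+ ∣ T ∪ image neighbour R ∣) (∣⁅x⁆∣≡1 v) ⟩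
      suc ∣ T ∪ image neighbour R ∣           ≤⟨ s≤s (∣p∪q∣≤∣p∣+∣q∣ T (image neighbour R)) ⟩
      suc (∣ T ∣ + ∣ image neighbour R ∣)     ≤⟨ s≤s (+-monoʳ-≤ ∣ T ∣ (∣image∣≤∣p∣ neighbour R)) ⟩
      suc (∣ T ∣ + ∣ R ∣)                     ∎

  SNbr-of-neighbour-of-v-unique : ∀ {a x y} → Adj G v a → SNbr a x → SNbr a y → x ≡ y
  SNbr-of-neighbour-of-v-unique {a} {x} {y} va (x∈S , ax) (y∈S , ay) with x ≟ y
  ... | yes x≡y = x≡y
  ... | no x≢y = contradiction 2≤1 (n≮n 1)
    where
    pair⊆S : ⁅ x ⁆ ∪ ⁅ y ⁆ ⊆ S
    pair⊆S z∈ with x∈⁅y⁆∪⁅z⁆⁻ z∈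
    ... | inj₁ refl = InS⇒∈S x∈S
    ... | inj₂ refl = InS⇒∈S y∈S

    a-dominates-pair : ∀ {z} → z ∈ ⁅ x ⁆ ∪ ⁅ y ⁆ → ∃ λ t → t ∈ ⁅ a ⁆ × Adj G z t
    a-dominates-pair z∈ with x∈⁅y⁆∪⁅z⁆⁻ z∈
    ... | inj₁ refl = a , x∈⁅x⁆ a , Adj-sym G ax
    ... | inj₂ refl = a , x∈⁅x⁆ a , Adj-sym G ay

    2≤1 : 2 ≤ 1
    2≤1 = ≤-trans (x≢y⇒2≤∣⁅x⁆∪⁅y⁆∣ x≢y)
            (≤-trans (dominated-bound va (x∈⁅x⁆ a) pair⊆S a-dominates-pair) (≤-reflexive (∣⁅x⁆∣≡1 a)))

  Cherry : Fin n → Fin n → Fin n → Set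
  Cherry s b c = InS s × SNbr s b × SNbr s c × b ≢ c

  cherry-swap : ∀ {s b c} → Cherry s b c → Cherry s c b
  cherry-swap (s∈S , sb , sc , b≢c) = s∈S , sc , sb , b≢c ∘ sym

  cherry-captures : ∀ {s b c a x} → Cherry s b c → Adj G v a → SNbr a x → x ≡ b ⊎ x ≡ c
  cherry-captures {s} {b} {c} {a} {x} (_ , (b∈S , sb) , (c∈S , sc) , b≢c) va (x∈S , ax) with x ≟ b | x ≟ c
  ... | yes x≡b | _ = inj₁ x≡b
  ... | no _ | yes x≡c = inj₂ x≡c
  ... | no x≢b | no x≢c = contradiction 3≤2 (n≮n 2)
    where
    triple⊆S : ⁅ x ⁆ ∪ (⁅ b ⁆ ∪ ⁅ c ⁆) ⊆ S
    triple⊆S z∈ with x∈⁅y⁆∪⁅z⁆∪⁅w⁆⁻ z∈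
    ... | inj₁ refl = InS⇒∈S x∈S
    ... | inj₂ (inj₁ refl) = InS⇒∈S b∈S
    ... | inj₂ (inj₂ refl) = InS⇒∈S c∈S

    as-dominates-triple : ∀ {z} → z ∈ ⁅ x ⁆ ∪ (⁅ b ⁆ ∪ ⁅ c ⁆) → ∃ λ t → t ∈ ⁅ a ⁆ ∪ ⁅ s ⁆ × Adj G z t
    as-dominates-triple z∈ with x∈⁅y⁆∪⁅z⁆∪⁅w⁆⁻ z∈
    ... | inj₁ refl = a , x∈p∪q⁺ (inj₁ (x∈⁅x⁆ a)) , Adj-sym G ax
    ... | inj₂ (inj₁ refl) = s , x∈p∪q⁺ (inj₂ (x∈⁅x⁆ s)) , Adj-sym G sb
    ... | inj₂ (inj₂ refl) = s , x∈p∪q⁺ (inj₂ (x∈⁅x⁆ s)) , Adj-sym G sc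

    3≤2 : 3 ≤ 2
    3≤2 = ≤-trans (distinct⇒3≤∣⁅x⁆∪⁅y⁆∪⁅z⁆∣ x≢b x≢c b≢c)
            (≤-trans (dominated-bound va (x∈p∪q⁺ (inj₁ (x∈⁅x⁆ a))) triple⊆S as-dominates-triple) (∣⁅x⁆∪⁅y⁆∣≤2 a s))

  cherry-leaf : ∀ {s b c d} → Cherry s b c → SNbr b d → d ≡ s
  cherry-leaf {s} {b} {c} {d} ch@(s∈S , (b∈S , sb) , (c∈S , sc) , b≢c) (d∈S , bd) with d ≟ s | anchor
  ... | yes d≡s | _ = d≡s
  ... | no d≢s | a , x , va , ax = ⊥-elim (impossible (cherry-captures ch va ax) (cherry-captures ch′ va ax))
    where
    ch′ : Cherry b s d
    ch′ = b∈S , (s∈S , Adj-sym G sb) , (d∈S , bd) , d≢s ∘ sym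

    triangle : d ≡ c → Cherry c s b
    triangle d≡c = c∈S , (s∈S , Adj-sym G sc) , (b∈S , Adj-sym G (subst (Adj G b) d≡c bd)) , Adj⇒≢ G sb

    impossible : x ≡ b ⊎ x ≡ c → x ≡ s ⊎ x ≡ d → Empty
    impossible (inj₁ x≡b) (inj₁ x≡s) = Adj⇒≢ G sb (trans (sym x≡s) x≡b)
    impossible (inj₁ x≡b) (inj₂ x≡d) = Adj⇒≢ G bd (trans (sym x≡b) x≡d)
    impossible (inj₂ x≡c) (inj₁ x≡s) = Adj⇒≢ G sc (trans (sym x≡s) x≡c)
    impossible (inj₂ x≡c) (inj₂ x≡d) =
      [ (λ x≡s → Adj⇒≢ G sc (trans (sym x≡s) x≡c)) , (λ x≡b → b≢c (trans (sym x≡b) x≡c)) ]′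
        (cherry-captures (triangle (trans (sym x≡d) x≡c)) va ax)

  cherry-centre-unique : ∀ {s b c s′ b′ c′} → Cherry s b c → Cherry s′ b′ c′ → s′ ≡ s
  cherry-centre-unique {s′ = s′} ch ch′@(s′∈S , (_ , s′b′) , (_ , s′c′) , _) with anchor
  ... | a , x , va , ax = [ leaf ch , leaf (cherry-swap ch) ]′ (cherry-captures ch va ax)
    where
    s′x : Adj G s′ x
    s′x = [ (λ x≡b′ → subst (Adj G s′) (sym x≡b′) s′b′) , (λ x≡c′ → subst (Adj G s′) (sym x≡c′) s′c′) ]′
            (cherry-captures ch′ va ax)

    leaf : ∀ {s b c} → Cherry s b c → x ≡ b → s′ ≡ s
    leaf ch x≡b = cherry-leaf ch (s′∈S , subst (λ z → Adj G z s′) x≡b (Adj-sym G s′x))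

  cherry-spans-S : ∀ {c p q y} → Cherry c p q → InS y → y ≡ p ⊎ y ≡ c ⊎ y ≡ q
  cherry-spans-S ch y∈S with S-neighbour _ (proj₁ y∈S)
  ... | w , yw with InNminus-nonempty G δ≥2 _ w
  ... | u , u∈Ny , u≢w with InS-neighbour-split y∈S (∈N⇒Adj G u∈Ny)
  ... | inj₁ vu = [ inj₁ , inj₂ ∘ inj₂ ]′ (cherry-captures ch vu (y∈S , Adj-sym G (∈N⇒Adj G u∈Ny)))
  ... | inj₂ u∈S = inj₂ (inj₁ (cherry-centre-unique ch (y∈S , yw , (u∈S , ∈N⇒Adj G u∈Ny) , u≢w ∘ sym)))

  cherry-isPathIso : ∀ {c p q} (C : Fin n → Set) → Cherry c p q →
                     (∀ i → C (path3 G p c q i)) → (∀ {y} → C y → InS y) → IsPathIso G C 3 (path3 G p c q)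
  cherry-isPathIso {c} {p} {q} C ch@(_ , (_ , cp) , (q∈S , cq) , p≢q) C∋path C⊆S =
    path3-injective G cp cq p≢q , C∋path , onto , path3-Adj⇔ G cp cq ¬pq
    where
    ¬pq : ¬ Adj G p q
    ¬pq pq = Adj⇒≢ G cq (sym (cherry-leaf ch (q∈S , pq)))

    onto : ∀ y → C y → ∃ λ i → path3 G p c q i ≡ y
    onto y Cy with cherry-spans-S ch (C⊆S Cy)
    ... | inj₁ y≡p = zero , sym y≡p
    ... | inj₂ (inj₁ y≡c) = suc zero , sym y≡c
    ... | inj₂ (inj₂ y≡q) = suc (suc zero) , sym y≡q

  cherry-component : ∀ {x c p q} → Cherry c p q → Reach G InS x c → IsoPath G (Comp G InS x) 3
  cherry-component {x} {c} {p} {q} ch@(_ , (p∈S , cp) , (q∈S , cq) , _) x⇝c =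
    path3 G p c q , cherry-isPathIso (Comp G InS x) ch reached (Reach⇒member G)
    where
    reached : ∀ i → Comp G InS x (path3 G p c q i)
    reached zero = step x⇝c cp p∈S
    reached (suc zero) = x⇝c
    reached (suc (suc zero)) = step x⇝c cq q∈S

  cherry-or-sole : ∀ {x w} → InS x → SNbr x w → (∃ λ z → Cherry x w z) ⊎ (∀ {z} → SNbr x z → z ≡ w)
  cherry-or-sole {x} {w} x∈S xw with any? (λ z → (InS? z ×-dec Adj? G x z) ×-dec ¬? (z ≟ w))
  ... | yes (z , xz , z≢w) = inj₁ (z , x∈S , xw , xz , z≢w ∘ sym)
  ... | no none = inj₂ λ {z} xz → decidable-stable (z ≟ w) λ z≢w → none (z , xz , z≢w)

  components-are-paths : (x : Fin n) → InS x → IsoPath G (Comp G InS x) 2 ⊎ IsoPath G (Comp G InS x) 3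
  components-are-paths x x∈S with S-neighbour x (proj₁ x∈S)
  ... | y , xy@(y∈S , x~y) with cherry-or-sole x∈S xy
  ... | inj₁ (_ , ch) = inj₂ (cherry-component ch (here x∈S))
  ... | inj₂ sole-x with cherry-or-sole y∈S (x∈S , Adj-sym G x~y)
  ... | inj₁ (_ , ch) = inj₂ (cherry-component ch (step (here x∈S) x~y y∈S))
  ... | inj₂ sole-y = inj₁ (path2 G x y , path2-injective G x~y , reached , onto , path2-Adj⇔ G x~y)
    where
    reached : ∀ i → Comp G InS x (path2 G x y i)
    reached zero = here x∈S
    reached (suc zero) = step (here x∈S) x~y y∈S

    onto : ∀ w → Comp G InS x w → ∃ λ i → path2 G x y i ≡ w
    onto w x⇝w with Reach-closed-pair G (λ w∈S xw → sole-x (w∈S , xw)) (λ w∈S yw → sole-y (w∈S , yw)) x⇝w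
    ... | inj₁ w≡x = zero , sym w≡x
    ... | inj₂ w≡y = suc zero , sym w≡y

  P3-component⇒cherry : ∀ {x} → IsoPath G (Comp G InS x) 3 → ∃₂ λ p c → ∃ λ q → Cherry c p q
  P3-component⇒cherry (g , g-injective , g∈C , _ , g-Adj⇔) =
    g zero , g (suc zero) , g (suc (suc zero)) ,
    Reach⇒member G (g∈C (suc zero)) ,
    (Reach⇒member G (g∈C zero) , Equivalence.from (g-Adj⇔ (suc zero) zero) (inj₂ refl)) ,
    (Reach⇒member G (g∈C (suc (suc zero))) , Equivalence.from (g-Adj⇔ (suc zero) (suc (suc zero))) (inj₁ refl)) ,
    λ p≡q → contradiction (g-injective p≡q) λ ()

  cherry-centre-misses-N[v] : ∀ {c p q} → Cherry c p q → ∀ y → ¬ (y ∈ N G c × y ∈ N G v)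
  cherry-centre-misses-N[v] ch@(c∈S , (_ , cp) , (_ , cq) , _) y (y∈Nc , y∈Nv) =
    [ Adj⇒≢ G cp , Adj⇒≢ G cq ]′ (cherry-captures ch (∈N⇒Adj G y∈Nv) (c∈S , Adj-sym G (∈N⇒Adj G y∈Nc)))

  cherry-leaf-N∖c⊆N[v] : ∀ {c p q y} → Cherry c p q → InNminus G p c y → y ∈ N G v
  cherry-leaf-N∖c⊆N[v] ch@(_ , (p∈S , _) , _) = sole-SNbr⇒N∖w⊆N[v] p∈S (cherry-leaf ch)

  cherry-leaves-cover-N[v] : ∀ {c p q y} → Cherry c p q → y ∈ N G v → InNminus G p c y ⊎ InNminus G q c y
  cherry-leaves-cover-N[v] ch@(c∈S , _) y∈Nv with neighbour-of-v-has-SNbr (∈N⇒Adj G y∈Nv)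
  ... | x , x∈S , yx with cherry-captures ch (∈N⇒Adj G y∈Nv) (x∈S , yx)
  ... | inj₁ refl = inj₁ (Adj⇒∈N G (Adj-sym G yx) , N[v]-vertex≢InS (∈N⇒Adj G y∈Nv) c∈S)
  ... | inj₂ refl = inj₂ (Adj⇒∈N G (Adj-sym G yx) , N[v]-vertex≢InS (∈N⇒Adj G y∈Nv) c∈S)

  cherry-leaves-N∖c-disjoint : ∀ {c p q} → Cherry c p q → ∀ y → ¬ (InNminus G p c y × InNminus G q c y)
  cherry-leaves-N∖c-disjoint ch@(_ , (p∈S , _) , (q∈S , _) , p≢q) y (y∈Np∖c , y∈Nq∖c) =
    p≢q (SNbr-of-neighbour-of-v-unique (∈N⇒Adj G (cherry-leaf-N∖c⊆N[v] ch y∈Np∖c))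
           (p∈S , Adj-sym G (∈N⇒Adj G (proj₁ y∈Np∖c))) (q∈S , Adj-sym G (∈N⇒Adj G (proj₁ y∈Nq∖c))))

  P3-structure : (∃ λ x → InS x × IsoPath G (Comp G InS x) 3) →
    ∃ λ (f : Fin 3 → Fin n) → IsPathIso G InS 3 f ×
      (∀ y → ¬ (y ∈ N G (f (suc zero)) × y ∈ N G v)) ×
      (∀ y → y ∈ N G v ⇔
         (InNminus G (f zero) (f (suc zero)) y ⊎ InNminus G (f (suc (suc zero))) (f (suc zero)) y)) ×
      (∀ y → ¬ (InNminus G (f zero) (f (suc zero)) y × InNminus G (f (suc (suc zero))) (f (suc zero)) y)) ×
      (∃ λ y → InNminus G (f zero) (f (suc zero)) y) ×
      (∃ λ y → InNminus G (f (suc (suc zero))) (f (suc zero)) y)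
  P3-structure (_ , _ , P3) with P3-component⇒cherry P3
  ... | p , c , q , ch@(c∈S , (p∈S , _) , (q∈S , _) , _) =
    path3 G p c q , cherry-isPathIso InS ch in-S (λ y∈S → y∈S) ,
    cherry-centre-misses-N[v] ch ,
    (λ y → mk⇔ (cherry-leaves-cover-N[v] ch) [ cherry-leaf-N∖c⊆N[v] ch , cherry-leaf-N∖c⊆N[v] (cherry-swap ch) ]′) ,
    cherry-leaves-N∖c-disjoint ch ,
    InNminus-nonempty G δ≥2 p c , InNminus-nonempty G δ≥2 q c
    where
    in-S : ∀ i → InS (path3 G p c q i)
    in-S zero = p∈S
    in-S (suc zero) = c∈S
    in-S (suc (suc zero)) = q∈S

  module AllP2 (all-P2 : (x : Fin n) → InS x → IsoPath G (Comp G InS x) 2) where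

    no-cherry : ∀ {s b c} → ¬ Cherry s b c
    no-cherry (s∈S , (b∈S , sb) , (c∈S , sc) , b≢c) with all-P2 _ s∈S
    ... | g , _ , _ , onto , _ =
      no-three-distinct-in-image-of-Fin2 g (onto _ (here s∈S)) (onto _ (step (here s∈S) sb b∈S))
        (onto _ (step (here s∈S) sc c∈S)) (Adj⇒≢ G sb) (Adj⇒≢ G sc) b≢c

    sole-SNbr : ∀ {u w} → InS u → SNbr u w → ∀ {z} → SNbr u z → z ≡ w
    sole-SNbr u∈S uw with cherry-or-sole u∈S uw
    ... | inj₁ (_ , ch) = ⊥-elim (no-cherry ch)
    ... | inj₂ sole = sole

    InS-meets-N[v] : (u : Fin n) → InS u → ∃ λ y → y ∈ N G u × y ∈ N G v
    InS-meets-N[v] u u∈S with S-neighbour u (proj₁ u∈S)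
    ... | w , uw with InNminus-nonempty G δ≥2 u w
    ... | y , y∈Nu∖w = y , proj₁ y∈Nu∖w , sole-SNbr⇒N∖w⊆N[v] u∈S (sole-SNbr u∈S uw) y∈Nu∖w

    N[v]-covered : ∀ y → y ∈ N G v → ∃ λ u → ∃ λ w → InS u × InS w × Adj G u w × InNminus G u w y
    N[v]-covered y y∈Nv with neighbour-of-v-has-SNbr (∈N⇒Adj G y∈Nv)
    ... | u , u∈S , yu with S-neighbour u (proj₁ u∈S)
    ... | w , w∈S , uw = u , w , u∈S , w∈S , uw , Adj⇒∈N G (Adj-sym G yu) , N[v]-vertex≢InS (∈N⇒Adj G y∈Nv) w∈S

    N∖w⊆N[v] : ∀ u w y → InS u → InS w → Adj G u w → InNminus G u w y → y ∈ N G v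
    N∖w⊆N[v] u w y u∈S w∈S uw = sole-SNbr⇒N∖w⊆N[v] u∈S (sole-SNbr u∈S (w∈S , uw))

    N∖w-disjoint : ∀ u w u′ w′ y → InS u → InS w → Adj G u w → InS u′ → InS w′ → Adj G u′ w′ →
                   InNminus G u w y → InNminus G u′ w′ y → (u ≡ u′ × w ≡ w′)
    N∖w-disjoint u w u′ w′ y u∈S w∈S uw u′∈S w′∈S u′w′ y∈Nu∖w y∈Nu′∖w′ = u≡u′ , w≡w′
      where
      u≡u′ : u ≡ u′
      u≡u′ = SNbr-of-neighbour-of-v-unique (∈N⇒Adj G (N∖w⊆N[v] u w y u∈S w∈S uw y∈Nu∖w))
               (u∈S , Adj-sym G (∈N⇒Adj G (proj₁ y∈Nu∖w))) (u′∈S , Adj-sym G (∈N⇒Adj G (proj₁ y∈Nu′∖w′)))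

      w≡w′ : w ≡ w′
      w≡w′ = sym (sole-SNbr u∈S (w∈S , uw) (w′∈S , subst (λ z → Adj G z w′) (sym u≡u′) u′w′))

  P2-structure : ((x : Fin n) → InS x → IsoPath G (Comp G InS x) 2) →
    ((u : Fin n) → InS u → ∃ λ y → y ∈ N G u × y ∈ N G v) ×
    (∀ y → y ∈ N G v → ∃ λ u → ∃ λ w → InS u × InS w × Adj G u w × InNminus G u w y) ×
    (∀ u w y → InS u → InS w → Adj G u w → InNminus G u w y → y ∈ N G v) ×
    (∀ u w u′ w′ y → InS u → InS w → Adj G u w → InS u′ → InS w′ → Adj G u′ w′ →
       InNminus G u w y → InNminus G u′ w′ y → (u ≡ u′ × w ≡ w′))
  P2-structure all-P2 = InS-meets-N[v] , N[v]-covered , N∖w⊆N[v] , N∖w-disjoint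
    where open AllP2 all-P2

lemma9 : {n : ℕ} (G : Graph n) → γt-critical G → MinDeg≥2 G →
  (k : ℕ) → IsγT G k → (v : Fin n) → IsMaxDeg G v → k ≡ n ∸ deg G v →
  ((x : Fin n) → OutS G v x →
    IsoPath G (Comp G (OutS G v) x) 2 ⊎ IsoPath G (Comp G (OutS G v) x) 3)
  ×
  ((∃ λ x → OutS G v x × IsoPath G (Comp G (OutS G v) x) 3) →
    ∃ λ (f : Fin 3 → Fin n) → IsPathIso G (OutS G v) 3 f ×
      (∀ y → ¬ (y ∈ N G (f (suc zero)) × y ∈ N G v)) ×
      (∀ y → y ∈ N G v ⇔
         (InNminus G (f zero) (f (suc zero)) y
           ⊎ InNminus G (f (suc (suc zero))) (f (suc zero)) y)) ×
      (∀ y → ¬ (InNminus G (f zero) (f (suc zero)) y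
                 × InNminus G (f (suc (suc zero))) (f (suc zero)) y)) ×
      (∃ λ y → InNminus G (f zero) (f (suc zero)) y) ×
      (∃ λ y → InNminus G (f (suc (suc zero))) (f (suc zero)) y))
  ×
  (((x : Fin n) → OutS G v x → IsoPath G (Comp G (OutS G v) x) 2) →
    ((u : Fin n) → OutS G v u → ∃ λ y → y ∈ N G u × y ∈ N G v) ×
    (∀ y → y ∈ N G v →
       ∃ λ u → ∃ λ w → OutS G v u × OutS G v w × Adj G u w × InNminus G u w y) ×
    (∀ u w y → OutS G v u → OutS G v w → Adj G u w → InNminus G u w y →
       y ∈ N G v) ×
    (∀ u w u′ w′ y → OutS G v u → OutS G v w → Adj G u w →
       OutS G v u′ → OutS G v w′ → Adj G u′ w′ →
       InNminus G u w y → InNminus G u′ w′ y → (u ≡ u′ × w ≡ w′)))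
lemma9 G crit δ≥2 k γt≡k v _ k≡n∸deg = components-are-paths , P3-structure , P2-structure
  where open CriticalWithγt≡n∸deg G crit δ≥2 k γt≡k v k≡n∸deg
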